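{- For every integer $d\geq 0$ there exists a finite block graph $G$ with $\alpha(G)-\alpha_{\min}(G)\geq d$ and $\chi_=(G)=\omega(G)$.
   Context: A block graph is a graph in which every block (maximal 2-connected subgraph, or bridge) is a clique (maximal complete subgraph); $\omega(G)$ is the size of a largest clique. $\alpha(G)$ is the maximum size of an independent set, $\alpha(G,v)$ the maximum size of an independent set containing $v$, and $\alpha_{\min}(G)=\min_v\alpha(G,v)$. An equitable $k$-coloring is a proper vertex coloring with colors $\{1,\dots,k\}$ in which every color class has size $\lfloor |V(G)|/k\rfloor$ or $\lceil |V(G)|/k\rceil$; $\chi_=(G)$ is the least $k$ admitting one. -}

module Defs where

open import Data.Nat using (ℕ; zero; suc; _+_; _≤_; _/_)
open import Data.Bool using (Bool; T)
open import Data.Fin using (Fin; _≟_)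
open import Data.Fin.Subset using (Subset; _∈_; _⊆_; _─_; ⁅_⁆; ∣_∣; Nonempty)
open import Data.List using (length; filter; allFin)
open import Data.Product using (Σ; ∃; _×_)
open import Data.Sum using (_⊎_)
open import Relation.Nullary using (¬_)
open import Relation.Binary.PropositionalEquality using (_≡_; _≢_)

record Graph (n : ℕ) : Set where
  field
    adj   : Fin n → Fin n → Bool
    sym   : ∀ u v → adj u v ≡ adj v u
    irrefl : ∀ v → adj v v ≡ Data.Bool.false

open Graph public

module _ {n : ℕ} (G : Graph n) where

  Edge : Fin n → Fin n → Set
  Edge u v = T (adj G u v)

  IsIndependent : Subset n → Set
  IsIndependent I = ∀ u v → u ∈ I → v ∈ I → ¬ Edge u v

  IsClique : Subset n → Set
  IsClique S = ∀ u v → u ∈ S → v ∈ S → u ≢ v → Edge u v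

  data PathIn (S : Subset n) : Fin n → Fin n → Set where
    here : ∀ {u} → u ∈ S → PathIn S u u
    step : ∀ {u w v} → u ∈ S → Edge u w → PathIn S w v → PathIn S u v

  -- G[S] is connected (the empty graph counts as connected)
  ConnectedOn : Subset n → Set
  ConnectedOn S = ∀ u v → u ∈ S → v ∈ S → PathIn S u v

  -- G[S] is nonempty, connected and has no cut vertex
  -- (2-connected subgraph, a bridge, or a single vertex)
  Biconnected : Subset n → Set
  Biconnected S = Nonempty S × ConnectedOn S
                  × (∀ v → v ∈ S → ConnectedOn (S ─ ⁅ v ⁆))

  IsBlock : Subset n → Set
  IsBlock S = Biconnected S × (∀ T → S ⊆ T → Biconnected T → T ⊆ S)

  IsBlockGraph : Set
  IsBlockGraph = ∀ S → IsBlock S → IsClique S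

  IsAlpha : ℕ → Set
  IsAlpha k = (Σ (Subset n) λ I → IsIndependent I × ∣ I ∣ ≡ k)
              × (∀ I → IsIndependent I → ∣ I ∣ ≤ k)

  IsAlphaAt : Fin n → ℕ → Set
  IsAlphaAt v k = (Σ (Subset n) λ I → IsIndependent I × v ∈ I × ∣ I ∣ ≡ k)
                  × (∀ I → IsIndependent I → v ∈ I → ∣ I ∣ ≤ k)

  IsAlphaMin : ℕ → Set
  IsAlphaMin k = (∃ λ v → IsAlphaAt v k) × (∀ v k' → IsAlphaAt v k' → k ≤ k')

  IsOmega : ℕ → Set
  IsOmega k = (Σ (Subset n) λ S → IsClique S × ∣ S ∣ ≡ k)
              × (∀ S → IsClique S → ∣ S ∣ ≤ k)

  classSize : ∀ {k} → (Fin n → Fin k) → Fin k → ℕ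
  classSize c i = length (filter (λ v → c v ≟ i) (allFin n))

  -- s ∈ {⌊n/k⌋, ⌈n/k⌉}
  EqSize : ℕ → ℕ → Set
  EqSize zero s = s ≡ 0   -- irrelevant: there are no colour classes when k = 0
  EqSize (suc k) s = s ≡ n / suc k ⊎ s ≡ (n + k) / suc k

  EquitableColoring : ℕ → Set
  EquitableColoring k = Σ (Fin n → Fin k) λ c →
      (∀ u v → Edge u v → c u ≢ c v) × (∀ i → EqSize k (classSize c i))

  IsEqChromatic : ℕ → Set
  IsEqChromatic k = EquitableColoring k × (∀ k' → EquitableColoring k' → k ≤ k')

module Submission where

-- For every d we exhibit the graph G_d on 2d + 2 vertices consisting of a star
-- with centre 0 and d + 1 leaves, together with d isolated vertices.
--
-- * Every edge of G_d meets the centre.  Any graph with this property is a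
--   block graph (a path leaving a non-central vertex must pass through the
--   centre, so a block containing two non-central vertices would have the
--   centre as a cut vertex), and all its cliques have at most 2 vertices.
-- * The non-central vertices are independent, so α(G_d) = 2d + 1; no
--   independent set contains both ends of an edge, so this is optimal.
-- * Colouring the centre and the isolated vertices 0 and the leaves 1 is a
--   proper colouring with two classes of size d + 1.  Hence the colouring is
--   equitable, χ_=(G_d) = ω(G_d) = 2, and every α(G_d, v) ≥ d + 1; an
--   independent set through the centre avoids all leaves, so α_min(G_d) = d + 1.

open import Defs hiding (sym)
open import Data.Bool using (Bool; true; false; T; _∧_; _∨_)
open import Data.Bool.Properties using (∨-comm)
open import Data.Empty using (⊥-elim)
open import Data.Fin using (Fin; zero; suc; _≟_)
open import Data.Fin.Subset
  using (Subset; _∈_; _∉_; _⊆_; _-_; _∪_; ⁅_⁆; ∁; ⊥; ∣_∣; inside; outside)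
open import Data.Fin.Subset.Properties
  using ( _∈?_; nonempty?; ∣p∣≤∣x∷p∣; p⊆q⇒∣p∣≤∣q∣; ∣∁p∣≡n∸∣p∣; ∣⁅x⁆∣≡1; ∣⊥∣≡0; ∉⊥
        ; x∈⁅x⁆; x∈⁅y⁆⇒x≡y; x∉⁅y⁆⇒x≢y; x∉p⇒x∈∁p; x∈∁p⇒x∉p; x∈p∧x≢y⇒x∈p-y
        ; x∈p∪q⁺; p─q⊆p )
import Data.List as List
open import Data.Nat using (ℕ; zero; suc; _+_; _*_; _∸_; _≤_; _/_; z≤n; s≤s)
open import Data.Nat.Properties
  using (≤-trans; ≤-reflexive; +-suc; +-monoʳ-≤; *-comm; +-identityʳ)
open import Data.Nat.DivMod using (m*n/n≡m)
open import Data.Product using (Σ; ∃; _×_; _,_; proj₁; proj₂)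
open import Data.Sum using (_⊎_; inj₁; inj₂)
open import Data.Unit using (tt)
open import Function using (_∘_)
open import Data.Vec using ([]; _∷_; tabulate; there)
open import Data.Vec.Properties using (lookup∘tabulate; []=⇒lookup; lookup⇒[]=)
open import Relation.Nullary using (¬_; Dec; yes; no; does)
open import Relation.Nullary.Decidable using (dec-true)
open import Relation.Binary.PropositionalEquality
  using (_≡_; _≢_; refl; sym; trans; cong; cong₂; subst)

private
  variable
    n k : ℕ

⟦_⟧ : {P : Fin n → Set} → (∀ v → Dec (P v)) → Subset n
⟦ P? ⟧ = tabulate (λ v → does (P? v))

∈⟦⟧⁺ : {P : Fin n → Set} (P? : ∀ v → Dec (P v)) {v : Fin n} → P v → v ∈ ⟦ P? ⟧
∈⟦⟧⁺ P? {v} pv =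
  lookup⇒[]= v ⟦ P? ⟧ (trans (lookup∘tabulate _ v) (dec-true (P? v) pv))

∈⟦⟧⁻ : {P : Fin n → Set} (P? : ∀ v → Dec (P v)) {v : Fin n} → v ∈ ⟦ P? ⟧ → P v
∈⟦⟧⁻ P? {v} v∈ with P? v | lookup∘tabulate (λ u → does (P? u)) v
... | yes pv | _      = pv
... | no  _  | v∉⟦P⟧ with trans (sym ([]=⇒lookup v∈)) v∉⟦P⟧
...   | ()

length-filter-tabulate : {A : Set} {P : A → Set} (P? : ∀ a → Dec (P a))
  (f : Fin n → A) →
  List.length (List.filter P? (List.tabulate f)) ≡ ∣ tabulate (λ v → does (P? (f v))) ∣
length-filter-tabulate {zero}  P? f = refl
length-filter-tabulate {suc n} P? f with does (P? (f zero))
... | true  = cong suc (length-filter-tabulate P? (λ v → f (suc v)))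
... | false = length-filter-tabulate P? (λ v → f (suc v))

∣∁⁅x⁆∣≡n∸1 : (x : Fin n) → ∣ ∁ ⁅ x ⁆ ∣ ≡ n ∸ 1
∣∁⁅x⁆∣≡n∸1 {n} x = trans (∣∁p∣≡n∸∣p∣ ⁅ x ⁆) (cong (n ∸_) (∣⁅x⁆∣≡1 x))

∉⇒∣p∣≤n∸1 : {p : Subset n} {x : Fin n} → x ∉ p → ∣ p ∣ ≤ n ∸ 1
∉⇒∣p∣≤n∸1 {n} {p} {x} x∉p = ≤-trans (p⊆q⇒∣p∣≤∣q∣ p⊆∁⁅x⁆) (≤-reflexive (∣∁⁅x⁆∣≡n∸1 x))
  where
  p⊆∁⁅x⁆ : p ⊆ ∁ ⁅ x ⁆
  p⊆∁⁅x⁆ y∈p = x∉p⇒x∈∁p λ y∈⁅x⁆ → x∉p (subst (_∈ p) (x∈⁅y⁆⇒x≡y x y∈⁅x⁆) y∈p)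

∣p∪q∣≤∣p∣+∣q∣ : (p q : Subset n) → ∣ p ∪ q ∣ ≤ ∣ p ∣ + ∣ q ∣
∣p∪q∣≤∣p∣+∣q∣ []            []            = z≤n
∣p∪q∣≤∣p∣+∣q∣ (inside  ∷ p) (s       ∷ q) =
  s≤s (≤-trans (∣p∪q∣≤∣p∣+∣q∣ p q) (+-monoʳ-≤ ∣ p ∣ (∣p∣≤∣x∷p∣ s q)))
∣p∪q∣≤∣p∣+∣q∣ (outside ∷ p) (inside  ∷ q) =
  ≤-trans (s≤s (∣p∪q∣≤∣p∣+∣q∣ p q)) (≤-reflexive (sym (+-suc ∣ p ∣ ∣ q ∣)))
∣p∪q∣≤∣p∣+∣q∣ (outside ∷ p) (outside ∷ q) = ∣p∪q∣≤∣p∣+∣q∣ p q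

x∉p-x : {p : Subset n} (x : Fin n) → x ∉ p - x
x∉p-x {p = _ ∷ _} zero    ()
x∉p-x {p = _ ∷ _} (suc x) (there x∈) = x∉p-x x x∈

module _ {n : ℕ} (G : Graph n) where

  edge-sym : {u v : Fin n} → Edge G u v → Edge G v u
  edge-sym {u} {v} = subst T (Graph.sym G u v)

  firstStep : {S : Subset n} {u v : Fin n} → PathIn G S u v → u ≢ v →
              ∃ λ w → Edge G u w × w ∈ S
  firstStep (here _)       u≢v = ⊥-elim (u≢v refl)
  firstStep (step _ uw wv) _   = _ , uw , start wv
    where
    start : ∀ {S a b} → PathIn G S a b → a ∈ S
    start (here a∈S)     = a∈S
    start (step a∈S _ _) = a∈S

  EdgesMeet : Fin n → Set
  EdgesMeet z = ∀ u v → Edge G u v → u ≢ z → v ≡ z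

  module _ {z : Fin n} (meet : EdgesMeet z) where

    leaveViaCentre : {S : Subset n} {u v : Fin n} → PathIn G S u v → u ≢ v →
                     u ≢ z → Edge G u z × z ∈ S
    leaveViaCentre p u≢v u≢z with firstStep p u≢v
    ... | w , uw , w∈S with meet _ w uw u≢z
    ...   | refl = uw , w∈S

    -- Two distinct vertices of a block are adjacent: if neither is the
    -- centre, the centre lies in the block and separates them.
    edgesMeet⇒blockGraph : IsBlockGraph G
    edgesMeet⇒blockGraph S ((_ , conn , noCut) , _) u v u∈S v∈S u≢v
      with u ≟ z | v ≟ z
    ... | yes refl | _ =
      edge-sym (proj₁ (leaveViaCentre (conn v u v∈S u∈S) (u≢v ∘ sym) (u≢v ∘ sym)))
    ... | no u≢z | yes refl = proj₁ (leaveViaCentre (conn u v u∈S v∈S) u≢v u≢z)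
    ... | no u≢z | no v≢z =
      ⊥-elim (x∉p-x z (proj₂ (leaveViaCentre pathAvoidingCentre u≢v u≢z)))
      where
      z∈S : z ∈ S
      z∈S = proj₂ (leaveViaCentre (conn u v u∈S v∈S) u≢v u≢z)
      pathAvoidingCentre : PathIn G (S - z) u v
      pathAvoidingCentre =
        noCut z z∈S u v (x∈p∧x≢y⇒x∈p-y u∈S u≢z) (x∈p∧x≢y⇒x∈p-y v∈S v≢z)

    clique⊆pair : {S : Subset n} → IsClique G S → ∃ λ w → S ⊆ ⁅ z ⁆ ∪ ⁅ w ⁆
    clique⊆pair {S} clique with nonempty? (S - z)
    ... | yes (w , w∈S-z) = w , λ x∈S → x∈p∪q⁺ (cover x∈S)
      where
      cover : ∀ {x} → x ∈ S → x ∈ ⁅ z ⁆ ⊎ x ∈ ⁅ w ⁆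
      cover {x} x∈S with x ≟ z | x ≟ w
      ... | yes refl | _        = inj₁ (x∈⁅x⁆ z)
      ... | no _     | yes refl = inj₂ (x∈⁅x⁆ w)
      ... | no x≢z   | no x≢w   with meet x w (clique x w x∈S (p─q⊆p S ⁅ z ⁆ w∈S-z) x≢w) x≢z
      ...   | refl = ⊥-elim (x∉p-x z w∈S-z)
    ... | no S-z-empty = z , λ x∈S → x∈p∪q⁺ (inj₁ (central x∈S))
      where
      central : ∀ {x} → x ∈ S → x ∈ ⁅ z ⁆
      central {x} x∈S with x ≟ z
      ... | yes refl = x∈⁅x⁆ z
      ... | no x≢z   = ⊥-elim (S-z-empty (x , x∈p∧x≢y⇒x∈p-y x∈S x≢z))

    clique≤2 : {S : Subset n} → IsClique G S → ∣ S ∣ ≤ 2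
    clique≤2 clique with clique⊆pair clique
    ... | w , S⊆pair = ≤-trans (p⊆q⇒∣p∣≤∣q∣ S⊆pair)
      (≤-trans (∣p∪q∣≤∣p∣+∣q∣ ⁅ z ⁆ ⁅ w ⁆)
               (≤-reflexive (cong₂ _+_ (∣⁅x⁆∣≡1 z) (∣⁅x⁆∣≡1 w))))

    ∁⁅z⁆-independent : IsIndependent G (∁ ⁅ z ⁆)
    ∁⁅z⁆-independent u v u∈ v∈ uv =
      x∈∁p⇒x∉p v∈ (subst (_∈ ⁅ z ⁆) (sym (meet u v uv (x∉⁅y⁆⇒x≢y (x∈∁p⇒x∉p u∈))))
                                     (x∈⁅x⁆ z))

    -- With at least one edge, α(G) = n ∸ 1: an independent set cannot
    -- contain both ends of that edge.
    edgesMeet⇒alpha : {a b : Fin n} → Edge G a b → IsAlpha G (n ∸ 1)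
    edgesMeet⇒alpha {a} {b} ab =
      (∁ ⁅ z ⁆ , ∁⁅z⁆-independent , ∣∁⁅x⁆∣≡n∸1 z) , bound
      where
      bound : ∀ I → IsIndependent G I → ∣ I ∣ ≤ n ∸ 1
      bound I independent with a ∈? I
      ... | no  a∉I = ∉⇒∣p∣≤n∸1 a∉I
      ... | yes a∈I = ∉⇒∣p∣≤n∸1 (λ b∈I → independent a b a∈I b∈I ab)

  Proper : (Fin n → Fin k) → Set
  Proper c = ∀ u v → Edge G u v → c u ≢ c v

  colourClass : (Fin n → Fin k) → Fin k → Subset n
  colourClass c i = ⟦ (λ v → c v ≟ i) ⟧

  classSize≡∣colourClass∣ : (c : Fin n → Fin k) (i : Fin k) →
                            classSize G c i ≡ ∣ colourClass c i ∣
  classSize≡∣colourClass∣ c i = length-filter-tabulate (λ v → c v ≟ i) (λ v → v)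

  colourClass-independent : {c : Fin n → Fin k} → Proper c →
                            (i : Fin k) → IsIndependent G (colourClass c i)
  colourClass-independent {c = c} proper i u v u∈ v∈ uv =
    proper u v uv (trans (∈⟦⟧⁻ (λ x → c x ≟ i) u∈) (sym (∈⟦⟧⁻ (λ x → c x ≟ i) v∈)))

  edge⇒2≤colours : {a b : Fin n} → Edge G a b →
                   (c : Fin n → Fin k) → Proper c → 2 ≤ k
  edge⇒2≤colours {k = zero}        {a} _  c _ with c a
  ... | ()
  edge⇒2≤colours {k = suc zero}    {a} {b} ab c proper with c a | c b | proper a b ab
  ... | zero | zero | ca≢cb = ⊥-elim (ca≢cb refl)
  edge⇒2≤colours {k = suc (suc _)} _  _ _ = s≤s (s≤s z≤n)

  balanced⇒eqChromatic2 : {a b : Fin n} → Edge G a b →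
    (c : Fin n → Fin 2) → Proper c → (∀ i → ∣ colourClass c i ∣ ≡ n / 2) →
    IsEqChromatic G 2
  balanced⇒eqChromatic2 ab c proper balanced =
    (c , proper , λ i → inj₁ (trans (classSize≡∣colourClass∣ c i) (balanced i)))
    , λ _ (c′ , proper′ , _) → edge⇒2≤colours ab c′ proper′

  -- Every vertex lies in an independent colour class, so if all classes have
  -- s elements then α(G, v) ≥ s for all v; a vertex attaining s gives α_min.
  balanced⇒alphaMin : {s : ℕ} {z : Fin n} (c : Fin n → Fin k) → Proper c →
    (∀ i → ∣ colourClass c i ∣ ≡ s) → IsAlphaAt G z s → IsAlphaMin G s
  balanced⇒alphaMin {s = s} {z = z} c proper sizes αz = (z , αz) , atLeast
    where
    atLeast : ∀ v k′ → IsAlphaAt G v k′ → s ≤ k′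
    atLeast v k′ (_ , bound) = subst (_≤ k′) (sizes (c v))
      (bound (colourClass c (c v)) (colourClass-independent proper (c v))
             (∈⟦⟧⁺ (λ x → c x ≟ c v) refl))

edgesMeet⇒omega : ∀ {m} (G : Graph (suc (suc m))) {z : Fin (suc (suc m))} →
  EdgesMeet G z → Edge G zero (suc zero) → IsOmega G 2
edgesMeet⇒omega {m} G meet e01 =
  (inside ∷ inside ∷ ⊥ , pairClique , cong (λ x → suc (suc x)) (∣⊥∣≡0 m))
  , λ _ → clique≤2 G meet
  where
  pairClique : IsClique G (inside ∷ inside ∷ ⊥)
  pairClique zero          zero          _ _ 0≢0 = ⊥-elim (0≢0 refl)
  pairClique zero          (suc zero)    _ _ _   = e01
  pairClique (suc zero)    zero          _ _ _   = edge-sym G e01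
  pairClique (suc zero)    (suc zero)    _ _ 1≢1 = ⊥-elim (1≢1 refl)
  pairClique (suc (suc u)) _ (there (there u∈⊥)) _ _ = ⊥-elim (∉⊥ u∈⊥)
  pairClique _ (suc (suc v)) _ (there (there v∈⊥)) _ = ⊥-elim (∉⊥ v∈⊥)

data Kind : Set where
  centre leaf isolated : Kind

isCentre : Kind → Bool
isCentre centre = true
isCentre _      = false

isLeaf : Kind → Bool
isLeaf leaf = true
isLeaf _    = false

linked : Kind → Kind → Bool
linked a b = (isCentre a ∧ isLeaf b) ∨ (isCentre b ∧ isLeaf a)

linked-irrefl : ∀ a → linked a a ≡ false
linked-irrefl centre   = refl
linked-irrefl leaf     = refl
linked-irrefl isolated = refl

linked-inv : ∀ a b → T (linked a b) →
             (a ≡ centre × b ≡ leaf) ⊎ (a ≡ leaf × b ≡ centre)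
linked-inv centre   leaf     _ = inj₁ (refl , refl)
linked-inv leaf     centre   _ = inj₂ (refl , refl)
linked-inv centre   centre   ()
linked-inv centre   isolated ()
linked-inv leaf     leaf     ()
linked-inv leaf     isolated ()
linked-inv isolated centre   ()
linked-inv isolated leaf     ()
linked-inv isolated isolated ()

alternate : Fin k → Kind
alternate zero          = leaf
alternate (suc zero)    = isolated
alternate (suc (suc x)) = alternate x

kind : Fin (suc (suc k)) → Kind
kind zero          = centre
kind (suc zero)    = leaf
kind (suc (suc x)) = alternate x

kind≡centre⇒zero : (v : Fin (suc (suc k))) → kind v ≡ centre → v ≡ zero
kind≡centre⇒zero zero          _  = refl
kind≡centre⇒zero (suc zero)    ()
kind≡centre⇒zero (suc (suc x)) eq = ⊥-elim (alternate≢centre x eq)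
  where
  alternate≢centre : ∀ {m} (y : Fin m) → alternate y ≢ centre
  alternate≢centre zero          ()
  alternate≢centre (suc zero)    ()
  alternate≢centre (suc (suc y)) = alternate≢centre y

starGraph : ∀ m → Graph (suc (suc m))
starGraph m = record
  { adj    = λ u v → linked (kind u) (kind v)
  ; sym    = λ u v → ∨-comm (isCentre (kind u) ∧ isLeaf (kind v))
                            (isCentre (kind v) ∧ isLeaf (kind u))
  ; irrefl = λ v → linked-irrefl (kind v)
  }

starGraph-edgesMeet : ∀ m → EdgesMeet (starGraph m) zero
starGraph-edgesMeet m u v uv u≢0 with linked-inv (kind u) (kind v) uv
... | inj₁ (u-centre , _) = ⊥-elim (u≢0 (kind≡centre⇒zero u u-centre))
... | inj₂ (_ , v-centre) = kind≡centre⇒zero v v-centre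

colour : Kind → Fin 2
colour centre   = zero
colour leaf     = suc zero
colour isolated = zero

colour-proper : ∀ m → Proper (starGraph m) (colour ∘ kind)
colour-proper m u v uv with kind u | kind v | linked-inv (kind u) (kind v) uv
... | _ | _ | inj₁ (refl , refl) = λ ()
... | _ | _ | inj₂ (refl , refl) = λ ()

nonNeighbour-colour : ∀ a → ¬ T (linked centre a) → colour a ≡ zero
nonNeighbour-colour centre   _       = refl
nonNeighbour-colour leaf     ¬linked = ⊥-elim (¬linked tt)
nonNeighbour-colour isolated _       = refl

alternating-size : ∀ d (i : Fin 2) →
  ∣ tabulate {n = d * 2} (λ x → does (colour (alternate x) ≟ i)) ∣ ≡ d
alternating-size zero    _          = refl
alternating-size (suc d) zero       = cong suc (alternating-size d zero)
alternating-size (suc d) (suc zero) = cong suc (alternating-size d (suc zero))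

colourClass-size : ∀ d (i : Fin 2) →
  ∣ colourClass (starGraph (d * 2)) (colour ∘ kind) i ∣ ≡ suc d
colourClass-size d zero       = cong suc (alternating-size d zero)
colourClass-size d (suc zero) = cong suc (alternating-size d (suc zero))

-- An independent set through the centre contains no leaf, so it lies in
-- colour class 0: α(G_d, centre) = d + 1.
centre-alpha : ∀ d → IsAlphaAt (starGraph (d * 2)) zero (suc d)
centre-alpha d =
  ( class₀ , colourClass-independent G (colour-proper (d * 2)) zero
  , ∈⟦⟧⁺ (λ v → colour (kind v) ≟ zero) refl , colourClass-size d zero )
  , bound
  where
  G : Graph (suc d * 2)
  G = starGraph (d * 2)
  class₀ : Subset (suc d * 2)
  class₀ = colourClass G (colour ∘ kind) zero
  bound : ∀ I → IsIndependent G I → zero ∈ I → ∣ I ∣ ≤ suc d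
  bound I independent 0∈I = subst (∣ I ∣ ≤_) (colourClass-size d zero)
    (p⊆q⇒∣p∣≤∣q∣ λ {v} v∈I → ∈⟦⟧⁺ (λ x → colour (kind x) ≟ zero)
      (nonNeighbour-colour (kind v) (independent zero v 0∈I v∈I)))

alpha-gap : ∀ d → d + suc d ≤ suc d * 2 ∸ 1
alpha-gap d = ≤-reflexive (trans (+-suc d d) (cong suc (sym d*2≡d+d)))
  where
  d*2≡d+d : d * 2 ≡ d + d
  d*2≡d+d = trans (*-comm d 2) (cong (d +_) (+-identityʳ d))

corollary4 : (d : ℕ) → Σ ℕ λ n → Σ (Graph n) λ G → IsBlockGraph G
    × (Σ ℕ λ a → Σ ℕ λ m → IsAlpha G a × IsAlphaMin G m × d + m ≤ a)
    × (Σ ℕ λ k → IsOmega G k × IsEqChromatic G k)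
corollary4 d =
  suc d * 2 , G , edgesMeet⇒blockGraph G meet
  , ( suc d * 2 ∸ 1 , suc d
    , edgesMeet⇒alpha G meet {zero} {suc zero} e01
    , balanced⇒alphaMin G c proper (colourClass-size d) (centre-alpha d)
    , alpha-gap d )
  , ( 2 , edgesMeet⇒omega G meet e01
    , balanced⇒eqChromatic2 G {zero} {suc zero} e01 c proper
        (λ i → trans (colourClass-size d i) (sym (m*n/n≡m (suc d) 2))) )
  where
  G : Graph (suc d * 2)
  G = starGraph (d * 2)
  meet : EdgesMeet G zero
  meet = starGraph-edgesMeet (d * 2)
  e01 : Edge G zero (suc zero)
  e01 = tt
  c : Fin (suc d * 2) → Fin 2
  c = colour ∘ kind
  proper : Proper G c
  proper = colour-proper (d * 2)
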